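{- If $n>1$ is a bi-unitary harmonic number, then $\omega(n)\ge 2$.
   Context: $\omega(n)$ is the number of distinct prime factors of $n$. A divisor $d$ of $n$ is a unitary divisor if $\gcd(d,n/d)=1$; a divisor $d$ of $n$ is a bi-unitary divisor if the greatest common unitary divisor of $d$ and $n/d$ is $1$. $\sigma^{**}(n)$ denotes the sum and $d^{**}(n)$ the number of bi-unitary divisors of $n$. $n$ is bi-unitary harmonic if $\sigma^{**}(n)\mid n\,d^{**}(n)$. -}

module Defs where

open import Data.Nat using (ℕ; zero; suc; _+_; _*_; _/_; _≟_)
open import Data.Nat.Divisibility using (_∣_; _∣?_)
open import Data.Nat.GCD using (gcd)
open import Data.Nat.Primality using (prime?)
open import Data.List using (List; []; _∷_; filter; upTo; length; drop)
open import Data.Nat.ListAction using (sum)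
open import Data.Product using (_×_; _,_)
open import Relation.Nullary using (Dec; yes; no; ¬_)
open import Relation.Nullary.Decidable using (_×-dec_)
open import Relation.Binary.PropositionalEquality using (_≡_)

-- quotient m / d, with the (irrelevant) convention m / 0 = 0
_div_ : ℕ → ℕ → ℕ
m div zero = 0
m div suc k = m / suc k

range1 : ℕ → List ℕ
range1 n = drop 1 (upTo (suc n))

divisors : ℕ → List ℕ
divisors n = filter (λ d → d ∣? n) (range1 n)

IsUnitaryDivisor : ℕ → ℕ → Set
IsUnitaryDivisor d m = (d ∣ m) × (gcd d (m div d) ≡ 1)

unitary? : ∀ d m → Dec (IsUnitaryDivisor d m)
unitary? d m = (d ∣? m) ×-dec (gcd d (m div d) ≟ 1)

-- greatest common unitary divisor of a and b (a, b ≥ 1):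
-- the largest u ∈ {1..a} that is a unitary divisor of both a and b
-- (1 is always one, so this is well defined and ≥ 1 for a ≥ 1)
maxList : List ℕ → ℕ
maxList [] = 0
maxList (x ∷ xs) = Data.Nat._⊔_ x (maxList xs)

gcud : ℕ → ℕ → ℕ
gcud a b = maxList (filter (λ u → unitary? u a ×-dec unitary? u b) (range1 a))

IsBiUnitaryDivisor : ℕ → ℕ → Set
IsBiUnitaryDivisor d n = (d ∣ n) × (gcud d (n div d) ≡ 1)

biUnitary? : ∀ d n → Dec (IsBiUnitaryDivisor d n)
biUnitary? d n = (d ∣? n) ×-dec (gcud d (n div d) ≟ 1)

biUnitaryDivisors : ℕ → List ℕ
biUnitaryDivisors n = filter (λ d → biUnitary? d n) (range1 n)

σ** : ℕ → ℕ
σ** n = sum (biUnitaryDivisors n)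

d** : ℕ → ℕ
d** n = length (biUnitaryDivisors n)

BiUnitaryHarmonic : ℕ → Set
BiUnitaryHarmonic n = σ** n ∣ n * d** n

ω : ℕ → ℕ
ω n = length (filter (λ p → prime? p ×-dec p ∣? n) (range1 n))

module Submission where

-- Suppose instead that p is the only prime dividing n.  The bi-unitary
-- divisors of n are 1 together with a nonempty list xs of divisors
-- exceeding 1 (it contains n itself), so
--     σ**(n) = 1 + Σ xs   and   d**(n) = 1 + |xs| .
-- Every divisor d > 1 of n is a multiple of p, hence p ∣ Σ xs and
-- p ∤ σ**(n); as p is the only prime of n, σ**(n) is coprime to n.
-- Thus σ**(n) ∣ n · d**(n) forces σ**(n) ∣ d**(n), which is impossible
-- because every element of xs is at least 2, so Σ xs ≥ 2|xs| > |xs|.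

open import Defs
open import Data.Nat using (ℕ; zero; suc; pred; _+_; _*_; _<_; _≤_; _≟_; _≤?_; z≤n; s≤s; NonZero)
open import Data.Nat.Base using (≢-nonZero⁻¹; >-nonZero⁻¹)
open import Data.Nat.Properties
open import Data.Nat.Divisibility
open import Data.Nat.DivMod using (n/n≡1)
open import Data.Nat.GCD using (gcd-zeroˡ)
open import Data.Nat.Coprimality using (Coprime; coprime-divisor)
open import Data.Nat.Primality using (Prime; prime?; ¬prime[1]; prime⇒nonZero)
open import Data.Nat.Primality.Factorisation using (factorise)
open import Data.Nat.ListAction using (sum; product)
open import Data.List using (List; []; _∷_; filter; length; applyUpTo)
open import Data.List.Properties using (filter-accept)
open import Data.List.Relation.Unary.Any using (here; there)
open import Data.List.Relation.Unary.All as All using (All; []; _∷_)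
open import Data.List.Membership.Propositional using (_∈_)
open import Data.List.Membership.Propositional.Properties
  using (∈-filter⁺; ∈-filter⁻; ∈-applyUpTo⁺; ∈-applyUpTo⁻)
open import Data.Product using (_×_; _,_; ∃-syntax; proj₁)
open import Data.Empty using (⊥-elim)
open import Relation.Nullary using (¬_; Dec; yes; no; _×-dec_)
open import Relation.Binary.PropositionalEquality
  using (_≡_; _≢_; refl; sym; subst; cong)

maxList-lub : ∀ {k} (xs : List ℕ) → All (_≤ k) xs → maxList xs ≤ k
maxList-lub []       []           = z≤n
maxList-lub (x ∷ xs) (x≤k ∷ xs≤k) = ⊔-lub x≤k (maxList-lub xs xs≤k)

maxList-upper : ∀ {u} (xs : List ℕ) → u ∈ xs → u ≤ maxList xs
maxList-upper (x ∷ xs) (here refl) = m≤m⊔n x (maxList xs)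
maxList-upper (x ∷ xs) (there u∈xs) =
  ≤-trans (maxList-upper xs u∈xs) (m≤n⊔m x (maxList xs))

distinct-members⇒2≤length : ∀ {x y} (xs : List ℕ) → x ∈ xs → y ∈ xs → x ≢ y → 2 ≤ length xs
distinct-members⇒2≤length (z ∷ zs)      (here refl) (here refl) x≢y = ⊥-elim (x≢y refl)
distinct-members⇒2≤length (z ∷ _ ∷ _)   (here refl) (there _)   _   = s≤s (s≤s z≤n)
distinct-members⇒2≤length (z ∷ _ ∷ _)   (there _)   (here refl) _   = s≤s (s≤s z≤n)
distinct-members⇒2≤length (z ∷ zs)      (there x∈)  (there y∈)  x≢y =
  m≤n⇒m≤1+n (distinct-members⇒2≤length zs x∈ y∈ x≢y)

member⇒0<length : ∀ {x} (xs : List ℕ) → x ∈ xs → 0 < length xs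
member⇒0<length (_ ∷ _) _ = s≤s z≤n

∣-sum : ∀ {d} (xs : List ℕ) → All (d ∣_) xs → d ∣ sum xs
∣-sum []       []           = _ ∣0
∣-sum (x ∷ xs) (d∣x ∷ d∣xs) = ∣m∣n⇒∣m+n d∣x (∣-sum xs d∣xs)

*-length≤sum : ∀ {k} (xs : List ℕ) → All (k ≤_) xs → k * length xs ≤ sum xs
*-length≤sum {k} []       []            = ≤-reflexive (*-zeroʳ k)
*-length≤sum {k} (x ∷ xs) (k≤x ∷ k≤xs) = begin
  k * suc (length xs)   ≡⟨ *-suc k (length xs) ⟩
  k + k * length xs     ≤⟨ +-mono-≤ k≤x (*-length≤sum xs k≤xs) ⟩
  x + sum xs            ∎
  where open ≤-Reasoning

∈-range1 : ∀ {d n} → 1 ≤ d → d ≤ n → d ∈ range1 n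
∈-range1 {suc i} _ d≤n = ∈-applyUpTo⁺ suc d≤n

primeFactor : ∀ {d} → 1 < d → ∃[ q ] Prime q × q ∣ d
primeFactor {suc zero} (s≤s ())
primeFactor {suc (suc k)} _ with factorise (2 + k)
... | record { factors = [] ; isFactorisation = () }
... | record { factors = q ∷ qs ; isFactorisation = d≡q*qs ; factorsPrime = q-prime ∷ _ } =
  q , q-prime , subst (q ∣_) (sym d≡q*qs) (m∣m*n (product qs))

OnlyPrimeFactor : ℕ → ℕ → Set
OnlyPrimeFactor p n = ∀ q → Prime q → q ∣ n → q ≡ p

onlyPrimeFactor⇒∣ : ∀ {p n d} → OnlyPrimeFactor p n → d ∣ n → 1 < d → p ∣ d
onlyPrimeFactor⇒∣ only d∣n 1<d with primeFactor 1<d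
... | q , q-prime , q∣d = subst (_∣ _) (only q q-prime (∣-trans q∣d d∣n)) q∣d

onlyPrimeFactor⇒coprime : ∀ {p n m} → .{{NonZero n}} →
                          OnlyPrimeFactor p n → ¬ p ∣ m → Coprime m n
onlyPrimeFactor⇒coprime {n = n} only p∤m {zero}        (_ , 0∣n)   =
  ⊥-elim (≢-nonZero⁻¹ n (0∣⇒≡0 0∣n))
onlyPrimeFactor⇒coprime         only p∤m {suc zero}    _           = refl
onlyPrimeFactor⇒coprime         only p∤m {suc (suc k)} (i∣m , i∣n) =
  ⊥-elim (p∤m (∣-trans (onlyPrimeFactor⇒∣ only i∣n (s≤s (s≤s z≤n))) i∣m))

prime∤1+multiple : ∀ {p m} → Prime p → p ∣ m → ¬ p ∣ 1 + m
prime∤1+multiple {p} {m} p-prime p∣m p∣1+m =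
  ¬prime[1] (subst Prime (∣1⇒≡1 p∣1) p-prime)
  where
  p∣1 : p ∣ 1
  p∣1 = ∣m+n∣m⇒∣n (subst (p ∣_) (+-comm 1 m) p∣1+m) p∣m

1+sum∤ : ∀ {p n x} → .{{NonZero n}} → Prime p → OnlyPrimeFactor p n →
         (xs : List ℕ) → x ∈ xs → All (λ d → 1 < d × d ∣ n) xs →
         ¬ (1 + sum xs ∣ n * (1 + length xs))
1+sum∤ {n = n} p-prime only xs x∈xs divisors∣n harmonic =
  <⇒≱ length<sum (∣⇒≤ sum∣length)
  where
  p∣sum : _ ∣ sum xs
  p∣sum = ∣-sum xs (All.map (λ (1<d , d∣n) → onlyPrimeFactor⇒∣ only d∣n 1<d) divisors∣n)

  sum∣length : 1 + sum xs ∣ 1 + length xs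
  sum∣length = coprime-divisor
    (onlyPrimeFactor⇒coprime only (prime∤1+multiple p-prime p∣sum)) harmonic

  length<sum : 1 + length xs < 1 + sum xs
  length<sum = s≤s (begin-strict
    length xs                ≡⟨ +-identityʳ (length xs) ⟨
    length xs + 0            <⟨ +-monoʳ-< (length xs) (member⇒0<length xs x∈xs) ⟩
    length xs + length xs    ≡⟨ cong (length xs +_) (+-identityʳ (length xs)) ⟨
    2 * length xs            ≤⟨ *-length≤sum xs (All.map proj₁ divisors∣n) ⟩
    sum xs                   ∎)
    where open ≤-Reasoning

1-unitary : ∀ b → IsUnitaryDivisor 1 b
1-unitary b = 1∣ b , gcd-zeroˡ (b div 1)

commonUnitary? : ∀ a b u → Dec (IsUnitaryDivisor u a × IsUnitaryDivisor u b)
commonUnitary? a b u = unitary? u a ×-dec unitary? u b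

commonUnitaryDivisors : ℕ → ℕ → List ℕ
commonUnitaryDivisors a b = filter (commonUnitary? a b) (range1 a)

gcud≡1 : ∀ {a b} → 1 ≤ a →
         (∀ u → IsUnitaryDivisor u a → IsUnitaryDivisor u b → u ≤ 1) → gcud a b ≡ 1
gcud≡1 {a} {b} 1≤a only1 = ≤-antisym
  (maxList-lub (commonUnitaryDivisors a b) (All.tabulate λ u∈ →
    let (_ , u∣∣a , u∣∣b) = ∈-filter⁻ (commonUnitary? a b) {xs = range1 a} u∈
    in only1 _ u∣∣a u∣∣b))
  (maxList-upper (commonUnitaryDivisors a b)
    (∈-filter⁺ (commonUnitary? a b) (∈-range1 ≤-refl 1≤a) (1-unitary a , 1-unitary b)))

unitary-of-1 : ∀ {u} → IsUnitaryDivisor u 1 → u ≤ 1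
unitary-of-1 (u∣1 , _) = ≤-reflexive (∣1⇒≡1 u∣1)

-- 1 and n are bi-unitary divisors of n: in both cases one side of the
-- pair (d, n/d) is 1, whose only unitary divisor is 1.
1-biUnitary : ∀ n → IsBiUnitaryDivisor 1 n
1-biUnitary n = 1∣ n , gcud≡1 {b = n div 1} ≤-refl λ _ u∣∣1 _ → unitary-of-1 u∣∣1

self-biUnitary : ∀ k → IsBiUnitaryDivisor (suc k) (suc k)
self-biUnitary k = ∣-refl ,
  subst (λ b → gcud (suc k) b ≡ 1) (sym (n/n≡1 (suc k)))
    (gcud≡1 {a = suc k} {b = 1} (s≤s z≤n) λ _ _ u∣∣1 → unitary-of-1 u∣∣1)

nontrivialBiUnitaryDivisors : ℕ → List ℕ
nontrivialBiUnitaryDivisors n = filter (λ d → biUnitary? d n) (applyUpTo (2 +_) (pred n))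

-- Since 1 is bi-unitary, the bi-unitary divisors of n ≥ 1 are 1 followed
-- by the nontrivial ones; this gives σ**(n) = 1 + Σ and d**(n) = 1 + length.
biUnitaryDivisors-split : ∀ k →
  biUnitaryDivisors (suc k) ≡ 1 ∷ nontrivialBiUnitaryDivisors (suc k)
biUnitaryDivisors-split k = filter-accept (λ d → biUnitary? d (suc k)) (1-biUnitary (suc k))

nontrivialBiUnitaryDivisors-∣ : ∀ n → All (λ d → 1 < d × d ∣ n) (nontrivialBiUnitaryDivisors n)
nontrivialBiUnitaryDivisors-∣ n = All.tabulate λ d∈ →
  bounds (∈-filter⁻ (λ d → biUnitary? d n) {xs = applyUpTo (2 +_) (pred n)} d∈)
  where
  bounds : ∀ {d} → d ∈ applyUpTo (2 +_) (pred n) × IsBiUnitaryDivisor d n → 1 < d × d ∣ n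
  bounds (d∈range , d∣n , _) with ∈-applyUpTo⁻ (2 +_) d∈range
  ... | _ , _ , refl = s≤s (s≤s z≤n) , d∣n

self-∈-nontrivialBiUnitaryDivisors : ∀ m → 2 + m ∈ nontrivialBiUnitaryDivisors (2 + m)
self-∈-nontrivialBiUnitaryDivisors m =
  ∈-filter⁺ (λ d → biUnitary? d (2 + m)) (∈-applyUpTo⁺ (2 +_) ≤-refl) (self-biUnitary (suc m))

primePower-¬biUnitaryHarmonic : ∀ {p n} → Prime p → OnlyPrimeFactor p n → 1 < n →
                                ¬ BiUnitaryHarmonic n
primePower-¬biUnitaryHarmonic {n = suc zero} _ _ (s≤s ())
primePower-¬biUnitaryHarmonic {n = suc (suc m)} p-prime only _ harmonic =
  1+sum∤ p-prime only (nontrivialBiUnitaryDivisors n)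
    (self-∈-nontrivialBiUnitaryDivisors m) (nontrivialBiUnitaryDivisors-∣ n)
    (subst (λ bus → sum bus ∣ n * length bus) (biUnitaryDivisors-split (suc m)) harmonic)
  where n = 2 + m

ω<2⇒onlyPrimeFactor : ∀ {p n} → .{{NonZero n}} → ¬ 2 ≤ ω n → Prime p → p ∣ n →
                      OnlyPrimeFactor p n
ω<2⇒onlyPrimeFactor {p} {n} ω≱2 p-prime p∣n q q-prime q∣n with q ≟ p
... | yes q≡p = q≡p
... | no  q≢p = ⊥-elim (ω≱2 (distinct-members⇒2≤length _
                  (counted q-prime q∣n) (counted p-prime p∣n) q≢p))
  where
  counted : ∀ {r} → Prime r → r ∣ n → r ∈ filter (λ r → prime? r ×-dec r ∣? n) (range1 n)
  counted r-prime r∣n = ∈-filter⁺ (λ r → prime? r ×-dec r ∣? n)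
    (∈-range1 (>-nonZero⁻¹ _ {{prime⇒nonZero r-prime}}) (∣⇒≤ r∣n)) (r-prime , r∣n)

mainTheorem7 : (n : ℕ) → 1 < n → BiUnitaryHarmonic n → 2 ≤ ω n
mainTheorem7 n@(suc _) 1<n harmonic with 2 ≤? ω n
... | yes 2≤ω = 2≤ω
... | no  ω≱2 with primeFactor 1<n
...   | p , p-prime , p∣n = ⊥-elim (primePower-¬biUnitaryHarmonic p-prime
                                      (ω<2⇒onlyPrimeFactor ω≱2 p-prime p∣n) 1<n harmonic)
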